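{- Let $G$ be a graph with maximum degree $\Delta=\Delta(G)$ and minimum degree $\delta(G)$ such that $e\Delta^2\leq 2^{\delta(G)-1}$. Then $\chi_d(G)\leq 2\chi(G)$.
   Context: All graphs are finite and simple; $e$ is Euler's number. A dynamic coloring of a graph $G$ is a proper vertex coloring such that every vertex of degree at least $2$ has neighbors of at least two different colors. The dynamic chromatic number $\chi_d(G)$ is the smallest number of colors in a dynamic coloring of $G$; $\chi(G)$ is the usual chromatic number. -}

module Defs where

open import Data.Nat using (ℕ; zero; suc; _+_; _*_; _^_; _≤_; _⊔_; _⊓_; _!)

open import Data.Bool using (Bool; true; false)
open import Data.Fin using (Fin)
open import Data.List using (List; map; foldr; filter; length; allFin; upTo; sum)
open import Data.Product using (Σ; _×_; ∃; ∃-syntax)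
open import Relation.Binary.PropositionalEquality using (_≡_; _≢_)
open import Relation.Nullary.Decidable using (Dec)
open import Data.Bool.Properties using (T?)
open import Data.Bool using (T)

record Graph : Set where
  field
    n     : ℕ
    adj   : Fin n → Fin n → Bool
    sym   : ∀ u v → adj u v ≡ adj v u
    irref : ∀ v → adj v v ≡ false
open Graph public

Adj : (G : Graph) → Fin (n G) → Fin (n G) → Set
Adj G u v = adj G u v ≡ true

deg : (G : Graph) → Fin (n G) → ℕ
deg G v = length (filter (λ w → T? (adj G v w)) (allFin (n G)))

-- maximum degree Δ(G) (0 for the empty graph)
maxDeg : Graph → ℕ
maxDeg G = foldr _⊔_ 0 (map (deg G) (allFin (n G)))

-- minimum degree δ(G); the seed n G exceeds every degree, so for a nonempty
-- graph this is exactly the minimum (for the empty graph it is 0)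
minDeg : Graph → ℕ
minDeg G = foldr _⊓_ (n G) (map (deg G) (allFin (n G)))

Proper : (G : Graph) (k : ℕ) → (Fin (n G) → Fin k) → Set
Proper G k c = ∀ u v → Adj G u v → c u ≢ c v

Colorable : Graph → ℕ → Set
Colorable G k = Σ (Fin (n G) → Fin k) (Proper G k)

Dynamic : (G : Graph) (k : ℕ) → (Fin (n G) → Fin k) → Set
Dynamic G k c = Proper G k c ×
  (∀ v → 2 ≤ deg G v → ∃[ u ] ∃[ w ] (Adj G v u × Adj G v w × c u ≢ c w))

DynColorable : Graph → ℕ → Set
DynColorable G k = Σ (Fin (n G) → Fin k) (Dynamic G k)

IsChromaticNumber : Graph → ℕ → Set
IsChromaticNumber G m = Colorable G m × (∀ k → Colorable G k → m ≤ k)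

IsDynChromaticNumber : Graph → ℕ → Set
IsDynChromaticNumber G m = DynColorable G m × (∀ k → DynColorable G k → m ≤ k)

-- Euler's number via its series e = Σ_k 1/k!.
-- eNum N = Σ_{k=0}^{N} N!/k!, so eNum N / N! is the N-th partial sum of e.
eNum : ℕ → ℕ
eNum zero    = 1
eNum (suc N) = suc N * eNum N + 1
-- (indeed Σ_{k≤N+1} (N+1)!/k! = (N+1)·Σ_{k≤N} N!/k! + 1)

-- e · a ≤ b  (for naturals a, b): since the partial sums increase to e,
-- this holds iff a · (N-th partial sum) ≤ b for every N.
e*_≤_ : ℕ → ℕ → Set
e* a ≤ b = ∀ N → a * eNum N ≤ b * (N !)

-- Colour the vertices by independent fair bits. The event that N(v) is monochromatic has
-- probability 2^(1-|N(v)|) ≤ 2^(1-δ), and it is mutually independent of the events of all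
-- w ≠ v with N(w) ∩ N(v) = ∅; the other w end walks of length two from v, so there are at
-- most Δ² - 1 of them. Since e · 2^(1-δ) · Δ² ≤ 1, the symmetric Lovász Local Lemma gives
-- bits under which no neighbourhood is monochromatic, and pairing them with an optimal
-- proper colouring gives a dynamic colouring with 2χ(G) colours. The local lemma is proved
-- by counting bit vectors: by induction on |S|, among those avoiding the events of S at most
-- a 1/(D+1) fraction hit A v; e enters through (1 + 1/D)^D ≤ e.

module Submission where

open import Defs renaming (sym to adj-sym)
open import Data.Nat hiding (_≟_)
open import Data.Nat.Properties hiding (_≟_)
open import Data.Nat.Combinatorics using (_C_; nCk≡n!/k![n-k]!; k![n∸k]!∣n!)
open import Data.Nat.DivMod using (m/n*n≡m)
open import Data.Nat.Induction using (<-wellFounded)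
open import Data.Nat.Tactic.RingSolver using (solve-∀)
open import Data.Bool using (Bool; true; false; _∧_; _∨_; not; _xor_)
open import Data.Bool.Properties using (T?; ∧-identityʳ; ∧-zeroʳ; ∨-zeroʳ; ∨-identityʳ; not-injective; not-involutive)
open import Data.Fin using (Fin; zero; suc; toℕ; _≟_; combine)
open import Data.Fin.Properties using (toℕ≤pred[n]; combine-injective)
open import Data.List using (map; foldr; filter; length; tabulate)
open import Data.Product using (Σ; ∃; ∃-syntax; _×_; _,_; proj₁; proj₂)
open import Data.Vec.Functional using (_∷_)
open import Function using (_∘_)
open import Induction.WellFounded using (module All)
open import Relation.Binary.PropositionalEquality
import Relation.Binary.Construct.On as On
open import Relation.Nullary using (contradiction; yes; no)
open import Relation.Nullary.Decidable using (does; dec-true; dec-false)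
open import Algebra.Properties.CommutativeSemigroup *-commutativeSemigroup using (x∙yz≈y∙xz)
open import Algebra.Properties.CommutativeSemigroup +-commutativeSemigroup using () renaming (interchange to +-interchange)
open import Algebra.Properties.Semiring.Sum +-*-semiring
  using (sum; sum-syntax; sum⁺-syntax; sum-cong-≗; ∑-comm; ∑-distrib-+; *-distribˡ-sum; *-distribʳ-sum)
open import Algebra.Properties.CommutativeSemiring.Binomial +-*-commutativeSemiring using () renaming (theorem to binomial-theorem)
import Algebra.Definitions.RawSemiring +-*-rawSemiring as Semiring

-- Finite subsets of Fin m, as characteristic functions

𝟙 : Bool → ℕ
𝟙 true  = 1
𝟙 false = 0

𝟙-mono : ∀ {x y} → (x ≡ true → y ≡ true) → 𝟙 x ≤ 𝟙 y
𝟙-mono {false}         _   = z≤n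
𝟙-mono {true}  {true}  _   = ≤-refl
𝟙-mono {true}  {false} x⇒y = contradiction (x⇒y refl) λ ()

all : ∀ {m} → (Fin m → Bool) → Bool
all {zero}  f = true
all {suc m} f = f zero ∧ all (f ∘ suc)

all-cong : ∀ {m} {f g : Fin m → Bool} → (∀ i → f i ≡ g i) → all f ≡ all g
all-cong {zero}  f≗g = refl
all-cong {suc m} f≗g = cong₂ _∧_ (f≗g zero) (all-cong (f≗g ∘ suc))

all-∧ : ∀ {m} (f g : Fin m → Bool) → all (λ i → f i ∧ g i) ≡ all f ∧ all g
all-∧ {zero}  f g = refl
all-∧ {suc m} f g rewrite all-∧ (f ∘ suc) (g ∘ suc) = interchange (f zero) (g zero) _ _
  where
  interchange : ∀ a b c d → (a ∧ b) ∧ (c ∧ d) ≡ (a ∧ c) ∧ (b ∧ d)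
  interchange true  true  c d = refl
  interchange true  false c d = sym (∧-zeroʳ c)
  interchange false b     c d = refl

all-true : ∀ {m} {f : Fin m → Bool} → (∀ i → f i ≡ true) → all f ≡ true
all-true {zero}  f≡true = refl
all-true {suc m} f≡true rewrite f≡true zero = all-true (f≡true ∘ suc)

all-elim : ∀ {m} {f : Fin m → Bool} → all f ≡ true → ∀ i → f i ≡ true
all-elim {suc m} {f} all≡true i with f zero in f₀ | i
... | true  | zero  = f₀
... | true  | suc i = all-elim all≡true i

all-false : ∀ {m} {f : Fin m → Bool} → all f ≡ false → ∃ λ i → f i ≡ false
all-false {suc m} {f} all≡false with f zero in f₀
... | false = zero , f₀
... | true  with all-false all≡false
...   | i , fi≡false = suc i , fi≡false

Subset : ℕ → Set
Subset m = Fin m → Bool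

module _ {m : ℕ} where

  ∅ : Subset m
  ∅ _ = false

  univ : Subset m
  univ _ = true

  ⁅_⁆ : Fin m → Subset m
  ⁅ w ⁆ i = does (i ≟ w)

  infixr 6 _∪_
  infixr 7 _∩_ _∖_
  infix 4 _⊆_

  _∪_ _∩_ _∖_ : Subset m → Subset m → Subset m
  (S ∪ T) i = S i ∨ T i
  (S ∩ T) i = S i ∧ T i
  (S ∖ T) i = S i ∧ not (T i)

  _⊆_ : Subset m → Subset m → Set
  T ⊆ S = ∀ {i} → T i ≡ true → S i ≡ true

  ∣_∣ : Subset m → ℕ
  ∣ S ∣ = sum (𝟙 ∘ S)

  allIn : Subset m → (Fin m → Bool) → Bool
  allIn S f = all (λ i → not (S i) ∨ f i)

  Disjoint : Subset m → Subset m → Set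
  Disjoint S T = ∀ {i} → S i ≡ true → T i ≡ false

⁅⁆-refl : ∀ {m} (w : Fin m) → ⁅ w ⁆ w ≡ true
⁅⁆-refl w = dec-true (w ≟ w) refl

⁅⁆-sound : ∀ {m} {i w : Fin m} → ⁅ w ⁆ i ≡ true → i ≡ w
⁅⁆-sound {i = i} {w} i∈⁅w⁆ with i ≟ w
... | yes i≡w = i≡w

∖-⊆ : ∀ {m} {S T : Subset m} → S ∖ T ⊆ S
∖-⊆ {S = S} {i = i} with S i
... | true  = λ _ → refl
... | false = λ ()

∩-⊆ˡ : ∀ {m} {S T : Subset m} → S ∩ T ⊆ S
∩-⊆ˡ {S = S} {i = i} with S i
... | true  = λ _ → refl
... | false = λ ()

∩-⊆ʳ : ∀ {m} {S T : Subset m} → S ∩ T ⊆ T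
∩-⊆ʳ {S = S} {i = i} with S i
... | true  = λ Tᵢ → Tᵢ
... | false = λ ()

∪-monoʳ : ∀ {m} {S T T′ : Subset m} → T′ ⊆ T → S ∪ T′ ⊆ S ∪ T
∪-monoʳ {S = S} T′⊆T {i} with S i
... | true  = λ _ → refl
... | false = T′⊆T

∖-disjoint : ∀ {m} (S T : Subset m) → Disjoint (S ∖ T) T
∖-disjoint S T {i} with S i | T i
... | true  | false = λ _ → refl
... | true  | true  = λ ()
... | false | _     = λ ()

∩-∖-disjoint : ∀ {m} (S T : Subset m) → Disjoint (S ∩ T) (S ∖ T)
∩-∖-disjoint S T {i} with S i | T i
... | true  | true  = λ _ → refl
... | true  | false = λ ()
... | false | _     = λ ()

∖-∪-∩ : ∀ {m} (S T : Subset m) i → (S ∖ T ∪ S ∩ T) i ≡ S i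
∖-∪-∩ S T i with S i | T i
... | true  | true  = refl
... | true  | false = refl
... | false | _     = refl

∖⁅⁆-∪⁅⁆ : ∀ {m} (S R : Subset m) {w} → R w ≡ true → ∀ i → ((S ∪ R ∖ ⁅ w ⁆) ∪ ⁅ w ⁆) i ≡ (S ∪ R) i
∖⁅⁆-∪⁅⁆ S R {w} Rw i with ⁅ w ⁆ i in i∈⁅w⁆
... | true  with refl ← ⁅⁆-sound {i = i} {w} i∈⁅w⁆ rewrite Rw = trans (∨-zeroʳ _) (sym (∨-zeroʳ (S w)))
... | false = trans (∨-identityʳ _) (cong (S i ∨_) (∧-identityʳ (R i)))

intersects : ∀ {m} → Subset m → Subset m → Bool
intersects S T = not (allIn S (not ∘ T))

allIn-cong : ∀ {m} (S : Subset m) {f g} → (∀ {i} → S i ≡ true → f i ≡ g i) → allIn S f ≡ allIn S g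
allIn-cong S {f} {g} f≗g = all-cong pointwise
  where
  pointwise : ∀ i → (not (S i) ∨ f i) ≡ (not (S i) ∨ g i)
  pointwise i with S i in Sᵢ
  ... | false = refl
  ... | true  = f≗g Sᵢ

allIn-congˡ : ∀ {m} {S T : Subset m} f → (∀ i → S i ≡ T i) → allIn S f ≡ allIn T f
allIn-congˡ f S≗T = all-cong (λ i → cong (λ x → not x ∨ f i) (S≗T i))

allIn-∅ : ∀ {m} (f : Fin m → Bool) → allIn ∅ f ≡ true
allIn-∅ {m} f = all-true {m} (λ _ → refl)

allIn-∪ : ∀ {m} (S T : Subset m) f → allIn (S ∪ T) f ≡ allIn S f ∧ allIn T f
allIn-∪ S T f = trans (all-cong (λ i → distrib (S i) (T i) (f i))) (all-∧ (λ i → not (S i) ∨ f i) (λ i → not (T i) ∨ f i))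
  where
  distrib : ∀ s t x → (not (s ∨ t) ∨ x) ≡ (not s ∨ x) ∧ (not t ∨ x)
  distrib true  true  true  = refl
  distrib true  true  false = refl
  distrib true  false true  = refl
  distrib true  false false = refl
  distrib false t     x     = refl

allIn-⁅⁆ : ∀ {m} (w : Fin m) f → allIn ⁅ w ⁆ f ≡ f w
allIn-⁅⁆ {suc m} zero    f = trans (cong (f zero ∧_) (all-true {m} (λ _ → refl))) (∧-identityʳ (f zero))
allIn-⁅⁆ {suc m} (suc w) f = allIn-⁅⁆ w (f ∘ suc)

allIn-elim : ∀ {m} (S : Subset m) f → allIn S f ≡ true → ∀ {i} → S i ≡ true → f i ≡ true
allIn-elim S f all≡true {i} Sᵢ with all-elim all≡true i
... | holds rewrite Sᵢ = holds

allIn-antitone : ∀ {m} {S T : Subset m} f → T ⊆ S → allIn S f ≡ true → allIn T f ≡ true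
allIn-antitone {m} {S} {T} f T⊆S all≡true = all-true {m} pointwise
  where
  pointwise : ∀ i → (not (T i) ∨ f i) ≡ true
  pointwise i with T i in Tᵢ
  ... | false = refl
  ... | true  = allIn-elim S f all≡true (T⊆S Tᵢ)

allIn-false : ∀ {m} (S : Subset m) f → allIn S f ≡ false → ∃ λ i → S i ≡ true × f i ≡ false
allIn-false S f all≡false with all-false all≡false
... | i , fails with S i in Sᵢ | f i in fᵢ
...   | true | false = i , Sᵢ , fᵢ

∑-mono-≤ : ∀ {n} {f g : Fin n → ℕ} → (∀ i → f i ≤ g i) → sum f ≤ sum g
∑-mono-≤ {zero}  f≤g = z≤n
∑-mono-≤ {suc n} f≤g = +-mono-≤ (f≤g zero) (∑-mono-≤ (f≤g ∘ suc))

≤-∑ : ∀ {m} (f : Fin m → ℕ) i → f i ≤ sum f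
≤-∑ f zero    = m≤m+n (f zero) _
≤-∑ f (suc i) = ≤-trans (≤-∑ (f ∘ suc) i) (m≤n+m _ (f zero))

∣⁅⁆∣≡1 : ∀ {m} (w : Fin m) → ∣ ⁅ w ⁆ ∣ ≡ 1
∣⁅⁆∣≡1 {suc m} zero    = cong suc (∣∅∣≡0 {m})
  where
  ∣∅∣≡0 : ∀ {m} → ∣ ∅ {m} ∣ ≡ 0
  ∣∅∣≡0 {zero}  = refl
  ∣∅∣≡0 {suc m} = ∣∅∣≡0 {m}
∣⁅⁆∣≡1 {suc m} (suc w) = ∣⁅⁆∣≡1 w

∣∣-mono : ∀ {m} {S T : Subset m} → T ⊆ S → ∣ T ∣ ≤ ∣ S ∣
∣∣-mono {zero}  T⊆S = z≤n
∣∣-mono {suc m} {S} {T} T⊆S = +-mono-≤ (𝟙-mono (T⊆S {zero})) (∣∣-mono {S = S ∘ suc} {T ∘ suc} T⊆S)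

∣∣-mono-< : ∀ {m} {S T : Subset m} {w} → T ⊆ S → S w ≡ true → T w ≡ false → ∣ T ∣ < ∣ S ∣
∣∣-mono-< {suc m} {S} {T} {zero}  T⊆S Sw Tw rewrite Sw | Tw = s≤s (∣∣-mono {S = S ∘ suc} {T ∘ suc} T⊆S)
∣∣-mono-< {suc m} {S} {T} {suc w} T⊆S Sw Tw =
  +-mono-≤-< (𝟙-mono (T⊆S {zero})) (∣∣-mono-< {S = S ∘ suc} {T ∘ suc} T⊆S Sw Tw)

∣∣≡0 : ∀ {m} {S : Subset m} → ∣ S ∣ ≡ 0 → ∀ i → S i ≡ false
∣∣≡0 {suc m} {S} ∣S∣≡0 i with S zero in S₀ | i
... | false | zero  = S₀
... | false | suc i = ∣∣≡0 ∣S∣≡0 i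

∣∣>0 : ∀ {m} {S : Subset m} → 0 < ∣ S ∣ → ∃ λ w → S w ≡ true
∣∣>0 {suc m} {S} 0<∣S∣ with S zero in S₀
... | true  = zero , S₀
... | false with ∣∣>0 {S = S ∘ suc} 0<∣S∣
...   | w , Sw = suc w , Sw

∣∣-remove : ∀ {m} {S : Subset m} {w} → S w ≡ true → ∣ S ∣ ≡ suc ∣ S ∖ ⁅ w ⁆ ∣
∣∣-remove {suc m} {S} {zero}  S₀ rewrite S₀ = cong suc (sum-cong-≗ λ i → cong 𝟙 (sym (∧-identityʳ (S (suc i)))))
∣∣-remove {suc m} {S} {suc w} Sw rewrite ∣∣-remove {S = S ∘ suc} Sw | ∧-identityʳ (S zero) = +-suc (𝟙 (S zero)) _

-- Counting Boolean assignments

Assignment : ℕ → Set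
Assignment k = Fin k → Bool

∑ᵃ : ∀ {k} → (Assignment k → ℕ) → ℕ
∑ᵃ {zero}  f = f (λ ())
∑ᵃ {suc k} f = ∑ᵃ (λ b → f (true ∷ b)) + ∑ᵃ (λ b → f (false ∷ b))

count : ∀ {k} → (Assignment k → Bool) → ℕ
count P = ∑ᵃ (𝟙 ∘ P)

∑ᵃ-cong : ∀ {k} {f g : Assignment k → ℕ} → (∀ b → f b ≡ g b) → ∑ᵃ f ≡ ∑ᵃ g
∑ᵃ-cong {zero}  f≗g = f≗g _
∑ᵃ-cong {suc k} f≗g = cong₂ _+_ (∑ᵃ-cong (f≗g ∘ (true ∷_))) (∑ᵃ-cong (f≗g ∘ (false ∷_)))

∑ᵃ-mono-≤ : ∀ {k} {f g : Assignment k → ℕ} → (∀ b → f b ≤ g b) → ∑ᵃ f ≤ ∑ᵃ g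
∑ᵃ-mono-≤ {zero}  f≤g = f≤g _
∑ᵃ-mono-≤ {suc k} f≤g = +-mono-≤ (∑ᵃ-mono-≤ (f≤g ∘ (true ∷_))) (∑ᵃ-mono-≤ (f≤g ∘ (false ∷_)))

∑ᵃ-distrib-+ : ∀ {k} (f g : Assignment k → ℕ) → ∑ᵃ (λ b → f b + g b) ≡ ∑ᵃ f + ∑ᵃ g
∑ᵃ-distrib-+ {zero}  f g = refl
∑ᵃ-distrib-+ {suc k} f g
  rewrite ∑ᵃ-distrib-+ (f ∘ (true ∷_)) (g ∘ (true ∷_)) | ∑ᵃ-distrib-+ (f ∘ (false ∷_)) (g ∘ (false ∷_))
  = +-interchange (∑ᵃ (f ∘ (true ∷_))) (∑ᵃ (g ∘ (true ∷_))) (∑ᵃ (f ∘ (false ∷_))) (∑ᵃ (g ∘ (false ∷_)))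

∑ᵃ-const : ∀ {k} c → ∑ᵃ {k} (λ _ → c) ≡ 2 ^ k * c
∑ᵃ-const {zero}  c = sym (*-identityˡ c)
∑ᵃ-const {suc k} c = begin
  ∑ᵃ {k} (λ _ → c) + ∑ᵃ {k} (λ _ → c) ≡⟨ cong₂ _+_ (∑ᵃ-const {k} c) (∑ᵃ-const {k} c) ⟩
  2 ^ k * c + 2 ^ k * c               ≡⟨ cong (2 ^ k * c +_) (sym (+-identityʳ _)) ⟩
  2 * (2 ^ k * c)                     ≡⟨ sym (*-assoc 2 (2 ^ k) c) ⟩
  2 ^ suc k * c                       ∎
  where open ≡-Reasoning

∑ᵃ-positive : ∀ {k} (f : Assignment k → ℕ) → 0 < ∑ᵃ f → ∃ λ b → 0 < f b
∑ᵃ-positive {zero}  f 0<f = _ , 0<f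
∑ᵃ-positive {suc k} f 0<∑ with ∑ᵃ (f ∘ (true ∷_)) in ∑₁
... | suc _ = let b , 0<fb = ∑ᵃ-positive (f ∘ (true ∷_)) (subst (0 <_) (sym ∑₁) z<s) in true ∷ b , 0<fb
... | zero  = let b , 0<fb = ∑ᵃ-positive (f ∘ (false ∷_)) 0<∑ in false ∷ b , 0<fb

count-positive : ∀ {k} (P : Assignment k → Bool) → 0 < count P → ∃ λ b → P b ≡ true
count-positive P 0<count with ∑ᵃ-positive (𝟙 ∘ P) 0<count
... | b , 0<𝟙 with P b in Pb
...   | true = b , Pb

count-none : ∀ {k} → count {k} (λ _ → false) ≡ 0
count-none {k} = trans (∑ᵃ-const {k} 0) (*-zeroʳ (2 ^ k))

count-select : ∀ {k} (R : Assignment k → Bool) (Q : Bool → Assignment k → Bool) c →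
  count (λ b → (not (c xor true) ∧ R b) ∧ Q true b) + count (λ b → (not (c xor false) ∧ R b) ∧ Q false b)
  ≡ count (λ b → R b ∧ Q c b)
count-select {k} R Q true  = trans (cong (count (λ b → R b ∧ Q true b) +_) (count-none {k})) (+-identityʳ _)
count-select {k} R Q false = cong (_+ count (λ b → R b ∧ Q false b)) (count-none {k})

constantOn : ∀ {k} → Subset k → Bool → Assignment k → Bool
constantOn N c b = allIn N (λ u → not (c xor b u))

IndependentOf : ∀ {k} → Subset k → (Assignment k → Bool) → Set
IndependentOf N B = ∀ b b′ → (∀ {i} → N i ≡ false → b i ≡ b′ i) → B b ≡ B b′

IndependentOf-∷ : ∀ {k} {N : Subset (suc k)} {B} x → IndependentOf N B → IndependentOf (N ∘ suc) (B ∘ (x ∷_))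
IndependentOf-∷ x indep b b′ agree = indep (x ∷ b) (x ∷ b′) λ { {zero} _ → refl ; {suc i} N′ᵢ → agree N′ᵢ }

count-constantOn : ∀ {k} (N : Subset k) c B → IndependentOf N B →
                   count (λ b → constantOn N c b ∧ B b) * 2 ^ ∣ N ∣ ≡ count B
count-constantOn {zero}  N c B _     = *-identityʳ _
count-constantOn {suc k} N c B indep with N zero in N₀
... | false = begin
  (count (restricted true) + count (restricted false)) * 2 ^ ∣ N′ ∣
    ≡⟨ *-distribʳ-+ (2 ^ ∣ N′ ∣) (count (restricted true)) _ ⟩
  count (restricted true) * 2 ^ ∣ N′ ∣ + count (restricted false) * 2 ^ ∣ N′ ∣
    ≡⟨ cong₂ _+_ (count-constantOn N′ c (B ∘ (true ∷_)) (IndependentOf-∷ true indep))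
                 (count-constantOn N′ c (B ∘ (false ∷_)) (IndependentOf-∷ false indep)) ⟩
  count B ∎
  where
  open ≡-Reasoning
  N′ : Subset k
  N′ = N ∘ suc
  restricted : Bool → Assignment k → Bool
  restricted x b = constantOn N′ c b ∧ B (x ∷ b)
... | true = begin
  (count (agreeing true) + count (agreeing false)) * (2 * 2 ^ ∣ N′ ∣)
    ≡⟨ cong (_* (2 * 2 ^ ∣ N′ ∣)) (count-select (constantOn N′ c) (λ x b → B (x ∷ b)) c) ⟩
  count (restricted c) * (2 * 2 ^ ∣ N′ ∣)
    ≡⟨ x∙yz≈y∙xz (count (restricted c)) 2 (2 ^ ∣ N′ ∣) ⟩
  2 * (count (restricted c) * 2 ^ ∣ N′ ∣)
    ≡⟨ cong (2 *_) (count-constantOn N′ c (B ∘ (c ∷_)) (IndependentOf-∷ c indep)) ⟩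
  2 * count (B ∘ (c ∷_))
    ≡⟨ free-coordinate c ⟩
  count B ∎
  where
  open ≡-Reasoning
  N′ : Subset k
  N′ = N ∘ suc
  agreeing restricted : Bool → Assignment k → Bool
  agreeing x b = (not (c xor x) ∧ constantOn N′ c b) ∧ B (x ∷ b)
  restricted x b = constantOn N′ c b ∧ B (x ∷ b)
  flip₀ : ∀ b → B (true ∷ b) ≡ B (false ∷ b)
  flip₀ b = indep _ _ λ { {zero} N₀≡false → contradiction (trans (sym N₀) N₀≡false) λ () ; {suc i} _ → refl }
  same-count : count (B ∘ (true ∷_)) ≡ count (B ∘ (false ∷_))
  same-count = ∑ᵃ-cong (cong 𝟙 ∘ flip₀)
  free-coordinate : ∀ x → 2 * count (B ∘ (x ∷_)) ≡ count B
  free-coordinate true  = cong (count (B ∘ (true ∷_)) +_) (trans (+-identityʳ _) same-count)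
  free-coordinate false =
    trans (cong (count (B ∘ (false ∷_)) +_) (+-identityʳ _)) (cong (_+ count (B ∘ (false ∷_))) (sym same-count))

constantOn-cong : ∀ {k} (N : Subset k) c {b b′} → (∀ {u} → N u ≡ true → b u ≡ b′ u) →
                  constantOn N c b ≡ constantOn N c b′
constantOn-cong N c agree = allIn-cong N λ Nu → cong (λ x → not (c xor x)) (agree Nu)

monochromatic : ∀ {k} → Subset k → Assignment k → Bool
monochromatic N b = constantOn N true b ∨ constantOn N false b

count-monochromatic : ∀ {k} {δ} (N : Subset k) B → δ ≤ ∣ N ∣ → IndependentOf N B →
                      count (λ b → monochromatic N b ∧ B b) * 2 ^ δ ≤ 2 * count B
count-monochromatic {δ = δ} N B δ≤∣N∣ indep = begin
  count (λ b → monochromatic N b ∧ B b) * 2 ^ δ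
    ≤⟨ *-mono-≤ (∑ᵃ-mono-≤ (λ b → union-bound (constantOn N true b) _ (B b))) (^-monoʳ-≤ 2 δ≤∣N∣) ⟩
  ∑ᵃ (λ b → 𝟙 (constantOn N true b ∧ B b) + 𝟙 (constantOn N false b ∧ B b)) * 2 ^ ∣ N ∣
    ≡⟨ cong (_* 2 ^ ∣ N ∣) (∑ᵃ-distrib-+ (λ b → 𝟙 (constantOn N true b ∧ B b)) _) ⟩
  (count (λ b → constantOn N true b ∧ B b) + count (λ b → constantOn N false b ∧ B b)) * 2 ^ ∣ N ∣
    ≡⟨ *-distribʳ-+ (2 ^ ∣ N ∣) (count (λ b → constantOn N true b ∧ B b)) _ ⟩
  count (λ b → constantOn N true b ∧ B b) * 2 ^ ∣ N ∣ + count (λ b → constantOn N false b ∧ B b) * 2 ^ ∣ N ∣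
    ≡⟨ cong₂ _+_ (count-constantOn N true B indep) (count-constantOn N false B indep) ⟩
  count B + count B
    ≡⟨ cong (count B +_) (sym (+-identityʳ (count B))) ⟩
  2 * count B ∎
  where
  open ≤-Reasoning
  union-bound : ∀ x y z → 𝟙 ((x ∨ y) ∧ z) ≤ 𝟙 (x ∧ z) + 𝟙 (y ∧ z)
  union-bound true  y true  = s≤s z≤n
  union-bound true  y false = z≤n
  union-bound false y z     = ≤-refl

monochromatic-cong : ∀ {k} (N : Subset k) {b b′} → (∀ {u} → N u ≡ true → b u ≡ b′ u) →
                     monochromatic N b ≡ monochromatic N b′
monochromatic-cong N agree = cong₂ _∨_ (constantOn-cong N true agree) (constantOn-cong N false agree)

-- The symmetric local lemma, in counting form

avoids : ∀ {k m} → (Fin m → Assignment k → Bool) → Subset m → Assignment k → Bool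
avoids A S b = allIn S (λ w → not (A w b))

-- hit-bound says Pr[A v | no event of S occurs] ≤ p/q for all S outside Γ v ∪ {v};
-- power-bound, p/q ≤ (1/(D+1)) (D/(D+1))^r for r ≤ D, follows from e (D+1) p/q ≤ 1.
module LocalLemma {k m} (A : Fin m → Assignment k → Bool) (Γ : Fin m → Subset m)
  (D p q : ℕ) .{{_ : NonZero D}} .{{_ : NonZero q}}
  (∣Γ∣≤D : ∀ v → ∣ Γ v ∣ ≤ D)
  (hit-bound : ∀ v S → S v ≡ false → Disjoint S (Γ v) →
               count (λ b → A v b ∧ avoids A S b) * q ≤ p * count (avoids A S))
  (power-bound : ∀ {r} → r ≤ D → p * suc D ^ suc r ≤ q * D ^ r)
  where

  #avoid : Subset m → ℕ
  #avoid S = count (avoids A S)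

  #hit : Fin m → Subset m → ℕ
  #hit v S = count (λ b → A v b ∧ avoids A S b)

  Rare : Subset m → Fin m → Set
  Rare S v = #hit v S * suc D ≤ #avoid S

  #avoid-cong : ∀ {S T} → (∀ i → S i ≡ T i) → #avoid S ≡ #avoid T
  #avoid-cong S≗T = ∑ᵃ-cong {k} λ b → cong 𝟙 (allIn-congˡ (λ w → not (A w b)) S≗T)

  #avoid-insert : ∀ S w → #avoid (S ∪ ⁅ w ⁆) + #hit w S ≡ #avoid S
  #avoid-insert S w = begin
    #avoid (S ∪ ⁅ w ⁆) + #hit w S
      ≡⟨ cong (_+ #hit w S) (∑ᵃ-cong (cong 𝟙 ∘ avoids-insert)) ⟩
    count (λ b → avoids A S b ∧ not (A w b)) + #hit w S
      ≡⟨ sym (∑ᵃ-distrib-+ (λ b → 𝟙 (avoids A S b ∧ not (A w b))) _) ⟩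
    ∑ᵃ (λ b → 𝟙 (avoids A S b ∧ not (A w b)) + 𝟙 (A w b ∧ avoids A S b))
      ≡⟨ ∑ᵃ-cong (λ b → split (avoids A S b) (A w b)) ⟩
    #avoid S ∎
    where
    open ≡-Reasoning
    avoids-insert : ∀ b → avoids A (S ∪ ⁅ w ⁆) b ≡ avoids A S b ∧ not (A w b)
    avoids-insert b = trans (allIn-∪ S ⁅ w ⁆ _) (cong (avoids A S b ∧_) (allIn-⁅⁆ w _))
    split : ∀ x y → 𝟙 (x ∧ not y) + 𝟙 (y ∧ x) ≡ 𝟙 x
    split true  true  = refl
    split true  false = refl
    split false true  = refl
    split false false = refl

  #avoid-insert-bound : ∀ S w → Rare S w → D * #avoid S ≤ suc D * #avoid (S ∪ ⁅ w ⁆)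
  #avoid-insert-bound S w rare-w = +-cancelʳ-≤ (#avoid S) _ _ (begin
    D * #avoid S + #avoid S                          ≡⟨ +-comm (D * #avoid S) _ ⟩
    suc D * #avoid S                                 ≡⟨ cong (suc D *_) (sym (#avoid-insert S w)) ⟩
    suc D * (#avoid (S ∪ ⁅ w ⁆) + #hit w S)          ≡⟨ *-distribˡ-+ (suc D) _ (#hit w S) ⟩
    suc D * #avoid (S ∪ ⁅ w ⁆) + suc D * #hit w S    ≤⟨ +-monoʳ-≤ _ (≤-trans (≤-reflexive (*-comm (suc D) _)) rare-w) ⟩
    suc D * #avoid (S ∪ ⁅ w ⁆) + #avoid S            ∎)
    where open ≤-Reasoning

  rare-member : ∀ {S v} → S v ≡ true → Rare S v
  rare-member {S} {v} Sv = ≤-trans (≤-reflexive (cong (_* suc D) none-hit)) z≤n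
    where
    none-hit : #hit v S ≡ 0
    none-hit = trans (∑ᵃ-cong (λ b → cong 𝟙 (excluded b))) (count-none {k})
      where
      excluded : ∀ b → (A v b ∧ avoids A S b) ≡ false
      excluded b with A v b in Avb | avoids A S b in avoid
      ... | false | _     = refl
      ... | true  | false = refl
      ... | true  | true  = contradiction (trans (cong not (sym Avb)) (allIn-elim S (λ w → not (A w b)) avoid Sv)) λ ()

  #hit-antitone : ∀ {S T} v → T ⊆ S → #hit v S ≤ #hit v T
  #hit-antitone {S} {T} v T⊆S = ∑ᵃ-mono-≤ {k} λ b → 𝟙-mono (still-avoids b)
    where
    still-avoids : ∀ b → (A v b ∧ avoids A S b) ≡ true → (A v b ∧ avoids A T b) ≡ true
    still-avoids b with A v b
    ... | true  = allIn-antitone (λ w → not (A w b)) T⊆S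
    ... | false = λ ()

  #avoid-∪-bound : ∀ n S R → ∣ R ∣ ≡ n → Disjoint R S →
                   (∀ T w → T ⊆ S ∪ R → R w ≡ true → T w ≡ false → Rare T w) →
                   D ^ n * #avoid S ≤ suc D ^ n * #avoid (S ∪ R)
  #avoid-∪-bound zero S R ∣R∣≡0 _ _ = *-monoʳ-≤ 1 (≤-reflexive (#avoid-cong S≗S∪R))
    where
    S≗S∪R : ∀ i → S i ≡ S i ∨ R i
    S≗S∪R i = sym (trans (cong (S i ∨_) (∣∣≡0 ∣R∣≡0 i)) (∨-identityʳ (S i)))
  #avoid-∪-bound (suc n) S R ∣R∣≡1+n R∩S≡∅ rare-inside with ∣∣>0 {S = R} (subst (0 <_) (sym ∣R∣≡1+n) z<s)
  ... | w , Rw = begin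
    D * D ^ n * #avoid S                      ≡⟨ *-assoc D (D ^ n) _ ⟩
    D * (D ^ n * #avoid S)                    ≤⟨ *-monoʳ-≤ D (#avoid-∪-bound n S R′ ∣R′∣≡n (R∩S≡∅ ∘ R′⊆R) rare′) ⟩
    D * (suc D ^ n * #avoid T)                ≡⟨ x∙yz≈y∙xz D (suc D ^ n) _ ⟩
    suc D ^ n * (D * #avoid T)                ≤⟨ *-monoʳ-≤ (suc D ^ n) (#avoid-insert-bound T w (rare-inside T w T⊆S∪R Rw Tw≡false)) ⟩
    suc D ^ n * (suc D * #avoid (T ∪ ⁅ w ⁆))  ≡⟨ cong (λ x → suc D ^ n * (suc D * x)) (#avoid-cong (∖⁅⁆-∪⁅⁆ S R Rw)) ⟩
    suc D ^ n * (suc D * #avoid (S ∪ R))      ≡⟨ x∙yz≈y∙xz (suc D ^ n) (suc D) _ ⟩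
    suc D * (suc D ^ n * #avoid (S ∪ R))      ≡⟨ sym (*-assoc (suc D) (suc D ^ n) _) ⟩
    suc D * suc D ^ n * #avoid (S ∪ R)        ∎
    where
    open ≤-Reasoning
    R′ T : Subset m
    R′ = R ∖ ⁅ w ⁆
    T = S ∪ R′
    R′⊆R : R′ ⊆ R
    R′⊆R = ∖-⊆ {S = R} {⁅ w ⁆}
    ∣R′∣≡n : ∣ R′ ∣ ≡ n
    ∣R′∣≡n = suc-injective (trans (sym (∣∣-remove {S = R} Rw)) ∣R∣≡1+n)
    T⊆S∪R : T ⊆ S ∪ R
    T⊆S∪R = ∪-monoʳ {S = S} {R} {R′} R′⊆R
    rare′ : ∀ T′ w′ → T′ ⊆ S ∪ R′ → R′ w′ ≡ true → T′ w′ ≡ false → Rare T′ w′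
    rare′ T′ w′ T′⊆S∪R′ R′w′ = rare-inside T′ w′ (T⊆S∪R ∘ T′⊆S∪R′) (R′⊆R R′w′)
    Tw≡false : T w ≡ false
    Tw≡false rewrite R∩S≡∅ Rw | ⁅⁆-refl w = ∧-zeroʳ (R w)

  -- Conditioned on avoiding S₂ = S ∖ Γ v, A v has probability at most p/q; adding back the
  -- r ≤ D events of S₁ = S ∩ Γ v shrinks #avoid by at most (D/(D+1))^r, which power-bound absorbs.
  rare-step : ∀ S → (∀ {T} → ∣ T ∣ < ∣ S ∣ → ∀ w → Rare T w) → ∀ v → Rare S v
  rare-step S IH v with S v in Sv
  ... | true  = rare-member Sv
  ... | false = *-cancelʳ-≤ _ _ (q * D ^ r) {{m*n≢0 q (D ^ r)}} (begin
    #hit v S * suc D * (q * D ^ r)           ≡⟨ regroup₁ (#hit v S) (suc D) q (D ^ r) ⟩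
    #hit v S * q * (suc D * D ^ r)           ≤⟨ *-monoˡ-≤ (suc D * D ^ r) (*-monoˡ-≤ q (#hit-antitone v (∖-⊆ {S = S} {Γ v}))) ⟩
    #hit v S₂ * q * (suc D * D ^ r)          ≤⟨ *-monoˡ-≤ (suc D * D ^ r) (hit-bound v S₂ S₂v≡false (∖-disjoint S (Γ v))) ⟩
    p * #avoid S₂ * (suc D * D ^ r)          ≡⟨ regroup₂ p (#avoid S₂) (suc D) (D ^ r) ⟩
    p * suc D * (D ^ r * #avoid S₂)          ≤⟨ *-monoʳ-≤ (p * suc D) adding-S₁ ⟩
    p * suc D * (suc D ^ r * #avoid S)       ≡⟨ regroup₃ p (suc D) (suc D ^ r) (#avoid S) ⟩
    p * suc D ^ suc r * #avoid S             ≤⟨ *-monoˡ-≤ (#avoid S) (power-bound r≤D) ⟩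
    q * D ^ r * #avoid S                     ≡⟨ *-comm (q * D ^ r) _ ⟩
    #avoid S * (q * D ^ r)                   ∎)
    where
    open ≤-Reasoning
    S₁ S₂ : Subset m
    S₁ = S ∩ Γ v
    S₂ = S ∖ Γ v
    r : ℕ
    r = ∣ S₁ ∣
    instance
      D^r≢0 : NonZero (D ^ r)
      D^r≢0 = m^n≢0 D r
    r≤D : r ≤ D
    r≤D = ≤-trans (∣∣-mono {S = Γ v} {S₁} (∩-⊆ʳ {S = S} {Γ v})) (∣Γ∣≤D v)
    S₂v≡false : S₂ v ≡ false
    S₂v≡false rewrite Sv = refl
    adding-S₁ : D ^ r * #avoid S₂ ≤ suc D ^ r * #avoid S
    adding-S₁ = subst (λ x → D ^ r * #avoid S₂ ≤ suc D ^ r * x) (#avoid-cong (∖-∪-∩ S (Γ v)))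
      (#avoid-∪-bound r S₂ S₁ refl (∩-∖-disjoint S (Γ v)) λ T w T⊆S₂∪S₁ S₁w Tw →
         IH (∣∣-mono-< {S = S} {T} {w} (λ {i} Tᵢ → trans (sym (∖-∪-∩ S (Γ v) i)) (T⊆S₂∪S₁ Tᵢ))
                                      (∩-⊆ˡ {S = S} {Γ v} S₁w) Tw) w)
    regroup₁ : ∀ h s q d → h * s * (q * d) ≡ h * q * (s * d)
    regroup₁ = solve-∀
    regroup₂ : ∀ p z s d → p * z * (s * d) ≡ p * s * (d * z)
    regroup₂ = solve-∀
    regroup₃ : ∀ p s t z → p * s * (t * z) ≡ p * (s * t) * z
    regroup₃ = solve-∀

  rare : ∀ S v → Rare S v
  rare = All.wfRec (On.wellFounded ∣_∣ <-wellFounded) _ (λ S → ∀ v → Rare S v) (λ S IH → rare-step S IH)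

  #avoid-univ>0 : 0 < #avoid univ
  #avoid-univ>0 = *-cancelˡ-< (suc D ^ M) 0 (#avoid univ) (begin-strict
    suc D ^ M * 0            ≡⟨ *-zeroʳ (suc D ^ M) ⟩
    0                        <⟨ *-mono-< (m^n>0 D M) (subst (0 <_) (sym #avoid-∅) (*-mono-< (m^n>0 2 k) z<s)) ⟩
    D ^ M * #avoid ∅         ≤⟨ #avoid-∪-bound M ∅ univ refl (λ _ → refl) (λ T w _ _ _ → rare T w) ⟩
    suc D ^ M * #avoid univ  ∎)
    where
    open ≤-Reasoning
    M : ℕ
    M = ∣ univ {m} ∣
    #avoid-∅ : #avoid ∅ ≡ 2 ^ k * 1
    #avoid-∅ = trans (∑ᵃ-cong {k} (λ b → cong 𝟙 (allIn-∅ (λ w → not (A w b))))) (∑ᵃ-const {k} 1)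

  all-avoided : ∃ λ b → ∀ v → A v b ≡ false
  all-avoided with count-positive (avoids A univ) #avoid-univ>0
  ... | b , avoids-all = b , λ v → not-injective (allIn-elim univ (λ w → not (A w b)) avoids-all refl)

-- (1 + 1/D)^D ≤ e

infix 8 _↓_
_↓_ : ℕ → ℕ → ℕ
m     ↓ zero  = 1
zero  ↓ suc k = 0
suc m ↓ suc k = suc m * (m ↓ k)

↓*[∸]!≡! : ∀ {m k} → k ≤ m → m ↓ k * (m ∸ k) ! ≡ m !
↓*[∸]!≡! {m}     {zero}  _         = +-identityʳ (m !)
↓*[∸]!≡! {suc m} {suc k} (s≤s k≤m) = trans (*-assoc (suc m) (m ↓ k) _) (cong (suc m *_) (↓*[∸]!≡! k≤m))

eNum≡∑↓ : ∀ m → eNum m ≡ ∑[ k ≤ m ] (m ↓ toℕ k)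
eNum≡∑↓ zero    = refl
eNum≡∑↓ (suc m) = begin
  suc m * eNum m + 1                      ≡⟨ +-comm _ 1 ⟩
  1 + suc m * eNum m                      ≡⟨ cong (λ x → 1 + suc m * x) (eNum≡∑↓ m) ⟩
  1 + suc m * (∑[ k ≤ m ] (m ↓ toℕ k))      ≡⟨ cong (1 +_) (*-distribˡ-sum {suc m} (suc m) (λ k → m ↓ toℕ k)) ⟩
  ∑[ k ≤ suc m ] (suc m ↓ toℕ k)           ∎
  where open ≡-Reasoning

!≤!*^ : ∀ k j → (k + j) ! ≤ k ! * (k + j) ^ j
!≤!*^ k zero    rewrite +-identityʳ k = ≤-reflexive (sym (*-identityʳ (k !)))
!≤!*^ k (suc j) rewrite +-suc k j = begin
  suc m * m !                  ≤⟨ *-monoʳ-≤ (suc m) (!≤!*^ k j) ⟩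
  suc m * (k ! * m ^ j)        ≤⟨ *-monoʳ-≤ (suc m) (*-monoʳ-≤ (k !) (^-monoˡ-≤ j (n≤1+n m))) ⟩
  suc m * (k ! * suc m ^ j)    ≡⟨ x∙yz≈y∙xz (suc m) (k !) _ ⟩
  k ! * (suc m * suc m ^ j)    ∎
  where
  open ≤-Reasoning
  m : ℕ
  m = k + j

C*!*!≡! : ∀ {n k} → k ≤ n → (n C k) * (k ! * (n ∸ k) !) ≡ n !
C*!*!≡! {n} {k} k≤n = begin
  (n C k) * (k ! * (n ∸ k) !)                ≡⟨ cong (_* (k ! * (n ∸ k) !)) (nCk≡n!/k![n-k]! k≤n) ⟩
  n ! / (k ! * (n ∸ k) !) * (k ! * (n ∸ k) !) ≡⟨ m/n*n≡m (k![n∸k]!∣n! k≤n) ⟩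
  n !                                      ∎
  where
  open ≡-Reasoning
  instance
    k!*[n∸k]!≢0 : NonZero (k ! * (n ∸ k) !)
    k!*[n∸k]!≢0 = k !* (n ∸ k) !≢0

-- In real terms C(D,k) D^k / D^D ≤ 1/(D-k)!, which compares the binomial expansion of
-- (1 + 1/D)^D with the series of e term by term.
binomialTerm≤ : ∀ {D k} → k ≤ D → (D C k) * (D ^ k * 1 ^ (D ∸ k)) * D ! ≤ D ^ D * D ↓ k
binomialTerm≤ {D} {k} k≤D = *-cancelʳ-≤ _ _ (k! * j!) {{k !* j !≢0}} (begin
  c * (D ^ k * 1 ^ j) * D ! * (k! * j!)  ≡⟨ cong (λ x → c * (D ^ k * x) * D ! * (k! * j!)) (^-zeroˡ j) ⟩
  c * (D ^ k * 1) * D ! * (k! * j!)      ≡⟨ regroup₁ c (D ^ k) (D !) k! j! ⟩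
  c * (k! * j!) * (D ! * D ^ k)          ≡⟨ cong (_* (D ! * D ^ k)) (C*!*!≡! k≤D) ⟩
  D ! * (D ! * D ^ k)                    ≤⟨ *-monoʳ-≤ (D !) (*-monoˡ-≤ (D ^ k) D!≤k!*D^j) ⟩
  D ! * (k! * D ^ j * D ^ k)             ≡⟨ regroup₂ (D !) k! (D ^ j) (D ^ k) ⟩
  D ^ k * D ^ j * D ! * k!               ≡⟨ cong₂ (λ x y → x * y * k!) D^k*D^j≡D^D (sym (↓*[∸]!≡! k≤D)) ⟩
  D ^ D * (D ↓ k * j!) * k!              ≡⟨ regroup₃ (D ^ D) (D ↓ k) j! k! ⟩
  D ^ D * D ↓ k * (k! * j!)              ∎)
  where
  open ≤-Reasoning
  c j k! j! : ℕ
  c = D C k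
  j = D ∸ k
  k! = k !
  j! = j !
  k+j≡D : k + j ≡ D
  k+j≡D = m+[n∸m]≡n k≤D
  D!≤k!*D^j : D ! ≤ k! * D ^ j
  D!≤k!*D^j = subst (λ n → n ! ≤ k! * n ^ j) k+j≡D (!≤!*^ k j)
  D^k*D^j≡D^D : D ^ k * D ^ j ≡ D ^ D
  D^k*D^j≡D^D = trans (sym (^-distribˡ-+-* D k j)) (cong (D ^_) k+j≡D)
  regroup₁ : ∀ c p f a b → c * (p * 1) * f * (a * b) ≡ c * (a * b) * (f * p)
  regroup₁ = solve-∀
  regroup₂ : ∀ f a q p → f * (a * q * p) ≡ p * q * f * a
  regroup₂ = solve-∀
  regroup₃ : ∀ e d b a → e * (d * b) * a ≡ e * d * (a * b)
  regroup₃ = solve-∀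

-- The library's binomial theorem uses the generic power and multiple of a semiring, which
-- agree with those of ℕ only propositionally.
^-semiring : ∀ x n → x Semiring.^ n ≡ x ^ n
^-semiring x zero    = refl
^-semiring x (suc n) = cong (x *_) (^-semiring x n)

×-semiring : ∀ n x → n Semiring.× x ≡ n * x
×-semiring zero    x = refl
×-semiring (suc n) x = cong (x +_) (×-semiring n x)

[1+D]^D*D!≤D^D*eNum : ∀ D → suc D ^ D * D ! ≤ D ^ D * eNum D
[1+D]^D*D!≤D^D*eNum D = begin
  suc D ^ D * D !                                        ≡⟨ cong (λ x → x ^ D * D !) (+-comm 1 D) ⟩
  (D + 1) ^ D * D !                                      ≡⟨ cong (_* D !) (sym (^-semiring (D + 1) D)) ⟩
  (D + 1) Semiring.^ D * D !                             ≡⟨ cong (_* D !) (binomial-theorem D D 1) ⟩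
  (∑[ k ≤ D ] ((D C toℕ k) Semiring.× (D Semiring.^ toℕ k * 1 Semiring.^ (D ∸ toℕ k)))) * D !
                                                         ≡⟨ cong (_* D !) (sum-cong-≗ {suc D} semiring-term) ⟩
  (∑[ k ≤ D ] (term k)) * D !                            ≡⟨ *-distribʳ-sum {suc D} (D !) term ⟩
  ∑[ k ≤ D ] (term k * D !)                              ≤⟨ ∑-mono-≤ {suc D} (λ k → binomialTerm≤ (toℕ≤pred[n] k)) ⟩
  ∑[ k ≤ D ] (D ^ D * D ↓ toℕ k)                         ≡⟨ *-distribˡ-sum {suc D} (D ^ D) (λ k → D ↓ toℕ k) ⟨
  D ^ D * (∑[ k ≤ D ] (D ↓ toℕ k))                       ≡⟨ cong (D ^ D *_) (eNum≡∑↓ D) ⟨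
  D ^ D * eNum D                                         ∎
  where
  open ≤-Reasoning
  term : Fin (suc D) → ℕ
  term k = (D C toℕ k) * (D ^ toℕ k * 1 ^ (D ∸ toℕ k))
  semiring-term : ∀ k → (D C toℕ k) Semiring.× (D Semiring.^ toℕ k * 1 Semiring.^ (D ∸ toℕ k)) ≡ term k
  semiring-term k = trans (×-semiring (D C toℕ k) _)
    (cong ((D C toℕ k) *_) (cong₂ _*_ (^-semiring D (toℕ k)) (^-semiring 1 (D ∸ toℕ k))))

[1+D]^[1+D]-bound : ∀ p q D → p * suc D * eNum D ≤ q * D ! → p * suc D ^ suc D ≤ q * D ^ D
[1+D]^[1+D]-bound p q D hyp = *-cancelʳ-≤ _ _ (D !) {{D !≢0}} (begin
  p * (suc D * suc D ^ D) * D !      ≡⟨ regroup₁ p (suc D) (suc D ^ D) (D !) ⟩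
  p * suc D * (suc D ^ D * D !)      ≤⟨ *-monoʳ-≤ (p * suc D) ([1+D]^D*D!≤D^D*eNum D) ⟩
  p * suc D * (D ^ D * eNum D)       ≡⟨ x∙yz≈y∙xz (p * suc D) (D ^ D) (eNum D) ⟩
  D ^ D * (p * suc D * eNum D)       ≤⟨ *-monoʳ-≤ (D ^ D) hyp ⟩
  D ^ D * (q * D !)                  ≡⟨ sym (*-assoc (D ^ D) q (D !)) ⟩
  D ^ D * q * D !                    ≡⟨ cong (_* D !) (*-comm (D ^ D) q) ⟩
  q * D ^ D * D !                    ∎)
  where
  open ≤-Reasoning
  regroup₁ : ∀ p s t f → p * (s * t) * f ≡ p * s * (t * f)
  regroup₁ = solve-∀

[1+D]^[1+r]-bound : ∀ p q D .{{_ : NonZero D}} → p * suc D * eNum D ≤ q * D ! →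
                ∀ {r} → r ≤ D → p * suc D ^ suc r ≤ q * D ^ r
[1+D]^[1+r]-bound p q D hyp {r} r≤D = *-cancelʳ-≤ _ _ (D ^ s) {{m^n≢0 D s}} (begin
  p * suc D ^ suc r * D ^ s          ≤⟨ *-monoʳ-≤ (p * suc D ^ suc r) (^-monoˡ-≤ s (n≤1+n D)) ⟩
  p * suc D ^ suc r * suc D ^ s      ≡⟨ *-assoc p _ _ ⟩
  p * (suc D ^ suc r * suc D ^ s)    ≡⟨ cong (p *_) (sym (^-distribˡ-+-* (suc D) (suc r) s)) ⟩
  p * suc D ^ (suc r + s)            ≡⟨ cong (λ x → p * suc D ^ suc x) r+s≡D ⟩
  p * suc D ^ suc D                  ≤⟨ [1+D]^[1+D]-bound p q D hyp ⟩
  q * D ^ D                          ≡⟨ cong (λ x → q * D ^ x) (sym r+s≡D) ⟩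
  q * D ^ (r + s)                    ≡⟨ cong (q *_) (^-distribˡ-+-* D r s) ⟩
  q * (D ^ r * D ^ s)                ≡⟨ sym (*-assoc q _ _) ⟩
  q * D ^ r * D ^ s                  ∎)
  where
  open ≤-Reasoning
  s : ℕ
  s = D ∸ r
  r+s≡D : r + s ≡ D
  r+s≡D = m+[n∸m]≡n r≤D

-- Graphs

length-filter-tabulate : ∀ {A : Set} {m} (f : Fin m → A) (P : A → Bool) →
                         length (filter (T? ∘ P) (tabulate f)) ≡ ∣ P ∘ f ∣
length-filter-tabulate {m = zero}  f P = refl
length-filter-tabulate {m = suc m} f P with P (f zero)
... | true  = cong suc (length-filter-tabulate (f ∘ suc) P)
... | false = length-filter-tabulate (f ∘ suc) P

≤-foldr-⊔ : ∀ {A : Set} {m} (f : Fin m → A) (g : A → ℕ) i → g (f i) ≤ foldr _⊔_ 0 (map g (tabulate f))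
≤-foldr-⊔ f g zero    = m≤m⊔n _ _
≤-foldr-⊔ f g (suc i) = ≤-trans (≤-foldr-⊔ (f ∘ suc) g i) (m≤n⊔m (g (f zero)) _)

foldr-⊓-≤ : ∀ {A : Set} {m} (f : Fin m → A) (g : A → ℕ) s i → foldr _⊓_ s (map g (tabulate f)) ≤ g (f i)
foldr-⊓-≤ f g s zero    = m⊓n≤m _ _
foldr-⊓-≤ f g s (suc i) = ≤-trans (m⊓n≤n (g (f zero)) _) (foldr-⊓-≤ (f ∘ suc) g s i)

module _ (G : Graph) where

  private
    V Δ δ : ℕ
    V = n G
    Δ = maxDeg G
    δ = minDeg G
    N : Fin V → Subset V
    N = adj G

  deg≡∣N∣ : ∀ v → deg G v ≡ ∣ N v ∣
  deg≡∣N∣ v = length-filter-tabulate (λ i → i) (N v)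

  ∣N∣≤maxDeg : ∀ v → ∣ N v ∣ ≤ Δ
  ∣N∣≤maxDeg v = subst (_≤ Δ) (deg≡∣N∣ v) (≤-foldr-⊔ (λ i → i) (deg G) v)

  minDeg≤∣N∣ : ∀ v → δ ≤ ∣ N v ∣
  minDeg≤∣N∣ v = subst (δ ≤_) (deg≡∣N∣ v) (foldr-⊓-≤ (λ i → i) (deg G) V v)

  Γ : Fin V → Subset V
  Γ v w = not (⁅ v ⁆ w) ∧ intersects (N v) (N w)

  ∣Γ∣<Δ*Δ : ∀ v → 0 < ∣ N v ∣ → ∣ Γ v ∣ < Δ * Δ
  ∣Γ∣<Δ*Δ v 0<∣Nv∣ = begin
    1 + ∣ Γ v ∣                                               ≡⟨ cong (_+ ∣ Γ v ∣) (sym (∣⁅⁆∣≡1 v)) ⟩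
    ∣ ⁅ v ⁆ ∣ + ∣ Γ v ∣                                       ≡⟨ sym (∑-distrib-+ (𝟙 ∘ ⁅ v ⁆) (𝟙 ∘ Γ v)) ⟩
    ∑[ w < V ] (𝟙 (⁅ v ⁆ w) + 𝟙 (Γ v w))                      ≤⟨ ∑-mono-≤ {V} walks-of-length-2 ⟩
    ∑[ w < V ] ∑[ u < V ] (𝟙 (N v u) * 𝟙 (N u w))             ≡⟨ ∑-comm (λ w u → 𝟙 (N v u) * 𝟙 (N u w)) ⟩
    ∑[ u < V ] ∑[ w < V ] (𝟙 (N v u) * 𝟙 (N u w))             ≡⟨ sum-cong-≗ (λ u → sym (*-distribˡ-sum (𝟙 (N v u)) (𝟙 ∘ N u))) ⟩
    ∑[ u < V ] (𝟙 (N v u) * ∣ N u ∣)                          ≤⟨ ∑-mono-≤ {V} (λ u → *-monoʳ-≤ (𝟙 (N v u)) (∣N∣≤maxDeg u)) ⟩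
    ∑[ u < V ] (𝟙 (N v u) * Δ)                                ≡⟨ sym (*-distribʳ-sum Δ (𝟙 ∘ N v)) ⟩
    ∣ N v ∣ * Δ                                               ≤⟨ *-monoˡ-≤ Δ (∣N∣≤maxDeg v) ⟩
    Δ * Δ                                                     ∎
    where
    open ≤-Reasoning
    walks-of-length-2 : ∀ w → 𝟙 (⁅ v ⁆ w) + 𝟙 (Γ v w) ≤ ∑[ u < V ] (𝟙 (N v u) * 𝟙 (N u w))
    walks-of-length-2 w with ⁅ v ⁆ w in w∈⁅v⁆
    ... | true with refl ← ⁅⁆-sound {i = w} {v} w∈⁅v⁆ | ∣∣>0 {S = N v} 0<∣Nv∣
    ...   | u , Nvu = ≤-trans (≤-reflexive (sym walk)) (≤-∑ (λ u → 𝟙 (N v u) * 𝟙 (N u v)) u)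
      where
      walk : 𝟙 (N v u) * 𝟙 (N u v) ≡ 1
      walk rewrite Nvu | adj-sym G u v | Nvu = refl
    walks-of-length-2 w | false with allIn (N v) (not ∘ N w) in disjoint
    ... | true  = z≤n
    ... | false with allIn-false (N v) (not ∘ N w) disjoint
    ...   | u , Nvu , Nwu = ≤-trans (≤-reflexive (sym walk)) (≤-∑ (λ u → 𝟙 (N v u) * 𝟙 (N u w)) u)
      where
      walk : 𝟙 (N v u) * 𝟙 (N u w) ≡ 1
      walk rewrite Nvu | adj-sym G u w | not-injective {N w u} {true} Nwu = refl

  private
    A : Fin V → Assignment V → Bool
    A v = monochromatic (N v)

  avoids-independent : ∀ v S → S v ≡ false → Disjoint S (Γ v) → IndependentOf (N v) (avoids A S)
  avoids-independent v S Sv S∩Γv≡∅ b b′ agree =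
    allIn-cong S λ {w} Sw → cong not (monochromatic-cong (N w) λ {u} Nwu → agree (outside Sw Nwu))
    where
    outside : ∀ {w u} → S w ≡ true → N w u ≡ true → N v u ≡ false
    outside {w} {u} Sw Nwu with N v u in Nvu
    ... | false = refl
    ... | true  = contradiction (trans (cong not (sym Nwu)) (allIn-elim (N v) (not ∘ N w) disjoint Nvu)) λ ()
      where
      w≢v : ⁅ v ⁆ w ≡ false
      w≢v = dec-false (w ≟ v) λ { refl → contradiction (trans (sym Sw) Sv) λ () }
      disjoint : allIn (N v) (not ∘ N w) ≡ true
      disjoint = not-injective (subst (λ x → not x ∧ intersects (N v) (N w) ≡ false) w≢v (S∩Γv≡∅ Sw))

  minDeg>0 : 0 < Δ → e* (2 * (Δ * Δ)) ≤ (2 ^ δ) → 0 < δ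
  minDeg>0 0<Δ hyp = ≰⇒> λ δ≤0 → <⇒≱ (*-monoˡ-≤ 1 (*-monoʳ-≤ 2 (*-mono-≤ 0<Δ 0<Δ)))
                                       (≤-trans (hyp 0) (*-monoˡ-≤ 1 (^-monoʳ-≤ 2 δ≤0)))

  no-monochromatic-neighbourhood : 1 < Δ → e* (2 * (Δ * Δ)) ≤ (2 ^ δ) → ∃ λ b → ∀ v → monochromatic (N v) b ≡ false
  no-monochromatic-neighbourhood 1<Δ hyp = LocalLemma.all-avoided A Γ D 2 (2 ^ δ) ∣Γ∣≤D hit-bound power-bound
    where
    D : ℕ
    D = pred (Δ * Δ)
    1+D≡Δ*Δ : suc D ≡ Δ * Δ
    1+D≡Δ*Δ = suc-pred (Δ * Δ) {{>-nonZero (*-mono-≤ (<⇒≤ 1<Δ) (<⇒≤ 1<Δ))}}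
    instance
      D≢0 : NonZero D
      D≢0 = >-nonZero (≤-trans (s≤s z≤n) (pred-mono-≤ (*-mono-≤ 1<Δ 1<Δ)))
      2^δ≢0 : NonZero (2 ^ δ)
      2^δ≢0 = m^n≢0 2 δ
    ∣Γ∣≤D : ∀ v → ∣ Γ v ∣ ≤ D
    ∣Γ∣≤D v = ≤-pred (subst (suc ∣ Γ v ∣ ≤_) (sym 1+D≡Δ*Δ)
                (∣Γ∣<Δ*Δ v (≤-trans (minDeg>0 (<⇒≤ 1<Δ) hyp) (minDeg≤∣N∣ v))))
    hit-bound : ∀ v S → S v ≡ false → Disjoint S (Γ v) →
                count (λ b → A v b ∧ avoids A S b) * 2 ^ δ ≤ 2 * count (avoids A S)
    hit-bound v S Sv S∩Γv≡∅ = count-monochromatic (N v) (avoids A S) (minDeg≤∣N∣ v) (avoids-independent v S Sv S∩Γv≡∅)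
    power-bound : ∀ {r} → r ≤ D → 2 * suc D ^ suc r ≤ 2 ^ δ * D ^ r
    power-bound = [1+D]^[1+r]-bound 2 (2 ^ δ) D (subst (λ x → 2 * x * eNum D ≤ 2 ^ δ * D !) (sym 1+D≡Δ*Δ) (hyp D))

  SeesBothColours : (Fin V → Bool) → Fin V → Set
  SeesBothColours b v = ∃[ u ] ∃[ w ] (Adj G v u × Adj G v w × b u ≢ b w)

  Splitting : (Fin V → Bool) → Set
  Splitting b = ∀ v → 2 ≤ deg G v → SeesBothColours b v

  sees-both-colours : ∀ b v → monochromatic (N v) b ≡ false → SeesBothColours b v
  sees-both-colours b v not-mono with constantOn (N v) true b in c₁ | constantOn (N v) false b in c₂
  ... | false | false with allIn-false (N v) _ c₁ | allIn-false (N v) _ c₂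
  ...   | u , Nvu , bu | w , Nvw , bw =
    u , w , Nvu , Nvw , λ bu≡bw → contradiction (trans (sym bu≡false) (trans bu≡bw (not-injective bw))) λ ()
    where
    bu≡false : b u ≡ false
    bu≡false = trans (sym (not-involutive (b u))) bu

  splitting : e* (2 * (Δ * Δ)) ≤ (2 ^ δ) → Σ (Fin V → Bool) Splitting
  splitting hyp with 2 ≤? Δ
  ... | yes 1<Δ = let b , unmixed = no-monochromatic-neighbourhood 1<Δ hyp in b , λ v _ → sees-both-colours b v (unmixed v)
  ... | no  Δ≱2 = (λ _ → true) , λ v 2≤deg →
    contradiction (≤-trans 2≤deg (subst (_≤ Δ) (sym (deg≡∣N∣ v)) (∣N∣≤maxDeg v))) Δ≱2

  doubled-colouring : ∀ {c} → Colorable G c → Σ (Fin V → Bool) Splitting → DynColorable G (2 * c)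
  doubled-colouring {c} (col , proper) (b , splits) = col′ , proper′ , dynamic
    where
    bit : Bool → Fin 2
    bit true  = zero
    bit false = suc zero
    bit-injective : ∀ {x y} → bit x ≡ bit y → x ≡ y
    bit-injective {true}  {true}  _ = refl
    bit-injective {false} {false} _ = refl
    col′ : Fin V → Fin (2 * c)
    col′ u = combine (bit (b u)) (col u)
    proper′ : Proper G (2 * c) col′
    proper′ u v uv same = proper u v uv (proj₂ (combine-injective (bit (b u)) (col u) (bit (b v)) (col v) same))
    dynamic : ∀ v → 2 ≤ deg G v → ∃[ u ] ∃[ w ] (Adj G v u × Adj G v w × col′ u ≢ col′ w)
    dynamic v 2≤deg with splits v 2≤deg
    ... | u , w , vu , vw , bu≢bw =
      u , w , vu , vw , λ same → bu≢bw (bit-injective (proj₁ (combine-injective (bit (b u)) (col u) (bit (b w)) (col w) same)))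

lemma2 : (G : Graph) →
    e* (2 * (maxDeg G * maxDeg G)) ≤ (2 ^ minDeg G) →
    ∀ c d → IsChromaticNumber G c → IsDynChromaticNumber G d → d ≤ 2 * c
lemma2 G hyp c d (colourable , _) (_ , minimal) = minimal (2 * c) (doubled-colouring G colourable (splitting G hyp))
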